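{- Fix a period $i\ge 1$. For every inventory level $f\ge 0$ that is attainable on arrival at period $i$, let $V_i(f)$ be the minimum of $\sum_{t=1}^{i-1}p_t(x_t)$ over all feasible order plans $(x_1,\dots,x_{i-1})$ with $I_{i-1}=f$, and define $p(i,f)=\min_P \ell(P)$, where the minimum ranges over all plans $P$ attaining $V_i(f)$ and $\ell(P)$ is the price $p_{2,t}$ of the last period $t\le i-1$ in which $P$ orders $x_t\ge Q$ units (with $\ell(P)=+\infty$ if $P$ has no such period). Then for any two attainable inventory levels $0\le f<w$ we have $p(i,f)\ge p(i,w)$.
   Context: Periods $t=1,2,\dots$ with demands $d_t\ge 0$ and integer order quantities $x_t\ge 0$. Inventory evolves as $I_t=I_{t-1}+x_t-d_t$ with $I_0=0$ and $I_t\ge 0$ for all $t$ (a plan is feasible if these hold). There is a single discount threshold $Q>0$; the purchase cost in period $t$ is $p_t(x)=p_{1,t}x$ if $x<Q$ and $p_t(x)=p_{2,t}x$ if $x\ge Q$, with $p_{2,t}\le p_{1,t}$. Prices are non-increasing over time: $p_{1,t}\ge p_{1,t+1}$ and $p_{2,t}\ge p_{2,t+1}$ for all $t$. In this setting there are no inventory capacity constraints and no holding costs.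
   Formalization: The demands $d_t$, the prices $p_{1,t}$ and $p_{2,t}$, the threshold $Q$ and the inventory levels $f$ and $w$ are rational. -}

module Defs where

open import Data.Nat as ℕ using (ℕ; zero; suc)
open import Data.Integer using (+_)
open import Data.Rational using (ℚ; _+_; _-_; _*_; _≤_; _<_; 0ℚ; _/_)
open import Data.Rational.Properties using (_≤?_)
open import Data.Bool using (if_then_else_)
open import Data.Maybe using (Maybe; just; nothing)
open import Data.Product using (Σ; _×_)
open import Relation.Nullary.Decidable using (⌊_⌋)

ℕ→ℚ : ℕ → ℚ
ℕ→ℚ n = (+ n) / 1

-- A problem instance.  Periods are t = 1, 2, … ; the value at index 0 is unused.
record Instance : Set where
  field
    d        : ℕ → ℚ
    Q        : ℚ
    p₁ p₂    : ℕ → ℚ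
    d≥0      : ∀ t → 0ℚ ≤ d t
    Q>0      : 0ℚ < Q
    p₂≤p₁    : ∀ t → p₂ t ≤ p₁ t
    p₁-mono  : ∀ t → p₁ (suc t) ≤ p₁ t
    p₂-mono  : ∀ t → p₂ (suc t) ≤ p₂ t

-- An order plan: x t is the (integer, nonnegative) order quantity in period t.
-- Only the entries for periods 1 … n matter for a plan over n periods.
Plan : Set
Plan = ℕ → ℕ

-- Extended prices ℚ ∪ {+∞}; nothing represents +∞.
ℚ∞ : Set
ℚ∞ = Maybe ℚ

infix 4 _≤∞_
data _≤∞_ : ℚ∞ → ℚ∞ → Set where
  fin≤fin : ∀ {a b} → a ≤ b → just a ≤∞ just b
  _≤∞top  : ∀ (a : ℚ∞) → a ≤∞ nothing

module _ (P : Instance) where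
  open Instance P

  purchase : ℕ → ℕ → ℚ
  purchase t x = if ⌊ Q ≤? ℕ→ℚ x ⌋ then p₂ t * ℕ→ℚ x else p₁ t * ℕ→ℚ x

  inv : Plan → ℕ → ℚ
  inv x zero    = 0ℚ
  inv x (suc t) = inv x t + ℕ→ℚ (x (suc t)) - d (suc t)

  cost : Plan → ℕ → ℚ
  cost x zero    = 0ℚ
  cost x (suc t) = cost x t + purchase (suc t) (x (suc t))

  lastPrice : Plan → ℕ → ℚ∞
  lastPrice x zero    = nothing
  lastPrice x (suc t) = if ⌊ Q ≤? ℕ→ℚ (x (suc t)) ⌋ then just (p₂ (suc t)) else lastPrice x t

  FeasibleTo : ℕ → ℚ → Plan → Set
  FeasibleTo n f x = (∀ t → t ℕ.≤ n → 0ℚ ≤ inv x t) × inv x n ≡ f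
    where open import Relation.Binary.PropositionalEquality using (_≡_)

  -- f is attainable on arrival at period n+1
  Attainable : ℕ → ℚ → Set
  Attainable n f = Σ Plan (FeasibleTo n f)

  Optimal : ℕ → ℚ → Plan → Set
  Optimal n f x = FeasibleTo n f x × (∀ y → FeasibleTo n f y → cost x n ≤ cost y n)

  -- v = p(n+1, f) = min { ℓ(P) | P attains V_{n+1}(f) }
  IsMinLastPrice : ℕ → ℚ → ℚ∞ → Set
  IsMinLastPrice n f v =
    Σ Plan (λ x → Optimal n f x × lastPrice x n ≡ v)
    × (∀ y → Optimal n f y → v ≤∞ lastPrice y n)
    where open import Relation.Binary.PropositionalEquality using (_≡_)

{-# OPTIONS --safe #-}

-- Let x be an optimal plan for f whose last discounted order is placed in period s (if there is
-- none, p(i,f) = ∞ and there is nothing to prove) and y an optimal plan for w.  It suffices to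
-- turn y into a feasible plan ordering the same total at no higher cost, with a discounted order
-- in period s or later: its last discount price is then at most p₂,s.  Let k > 0 be the surplus
-- of y over x and M the last period in which y orders.  If y's order at M is discounted and
-- M ≥ s, y itself will do.  If removing k units from it leaves a discounted order, or it is not
-- discounted but at least k, the trimmed plan orders as much as x and so costs at least as much;
-- then x with k more units in period s (respectively in the last period) works, because prices
-- do not increase over time.  If y's order at M is discounted but y_M − k is not, the whole
-- order moves to period s, which stays feasible since y_M − k < Q ≤ x_s.  Otherwise y_M < k is
-- not discounted: drop it, recurse on the earlier periods and add y_M to the last period.

module Submission where

open import Defs

module Preliminaries where

  import Data.Integer.Base as ℤ
  import Data.Integer.Properties as ℤ
  open import Data.Sum.Base using (inj₁; inj₂)
  open import Data.Nat.Base as ℕ using (ℕ; zero; suc)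
  import Data.Nat.Properties as ℕ
  open import Data.Rational.Base
  open import Data.Rational.Properties
  import Data.Rational.Unnormalised.Base as ℚᵘ
  import Data.Rational.Unnormalised.Properties as ℚᵘ
  open import Level using (0ℓ)
  open import Relation.Binary.Core using (Rel)
  open import Relation.Binary.Definitions using (Reflexive; Transitive)
  open import Relation.Binary.PropositionalEquality

  stepwise-monotone : ∀ {A : Set} (_∼_ : Rel A 0ℓ) → Reflexive _∼_ → Transitive _∼_ →
                      (f : ℕ → A) → (∀ t → f t ∼ f (suc t)) → ∀ {m t} → m ℕ.≤ t → f m ∼ f t
  stepwise-monotone _∼_ refl′ trans′ f step {t = zero}  ℕ.z≤n = refl′
  stepwise-monotone _∼_ refl′ trans′ f step {t = suc t} m≤1+t with ℕ.m≤n⇒m<n∨m≡n m≤1+t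
  ... | inj₁ m<1+t = trans′ (stepwise-monotone _∼_ refl′ trans′ f step (ℕ.≤-pred m<1+t)) (step t)
  ... | inj₂ refl = refl′

  -- ℕ→ℚ k is definitionally fromℚᵘ (ι k).
  ℕ→ℚ-homo-+ : ∀ m n → ℕ→ℚ (m ℕ.+ n) ≡ ℕ→ℚ m + ℕ→ℚ n
  ℕ→ℚ-homo-+ m n = toℚᵘ-injective (begin
    toℚᵘ (ℕ→ℚ (m ℕ.+ n))             ≈⟨ toℚᵘ-fromℚᵘ (ι (m ℕ.+ n)) ⟩
    ι (m ℕ.+ n)                      ≈⟨ ℚᵘ.*≡* numerators ⟩
    ι m ℚᵘ.+ ι n                     ≈⟨ ℚᵘ.+-cong (toℚᵘ-fromℚᵘ (ι m)) (toℚᵘ-fromℚᵘ (ι n)) ⟨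
    toℚᵘ (ℕ→ℚ m) ℚᵘ.+ toℚᵘ (ℕ→ℚ n) ≈⟨ toℚᵘ-homo-+ (ℕ→ℚ m) (ℕ→ℚ n) ⟨
    toℚᵘ (ℕ→ℚ m + ℕ→ℚ n)            ∎)
    where
    open ℚᵘ.≃-Reasoning
    ι : ℕ → ℚᵘ.ℚᵘ
    ι k = ℚᵘ.mkℚᵘ (ℤ.+ k) 0
    numerators : ℤ.+ (m ℕ.+ n) ℤ.* ℤ.+ 1 ≡ (ℤ.+ m ℤ.* ℤ.+ 1 ℤ.+ ℤ.+ n ℤ.* ℤ.+ 1) ℤ.* ℤ.+ 1
    numerators = trans (ℤ.*-identityʳ _) (trans (ℤ.pos-+ m n) (sym (trans (ℤ.*-identityʳ _)
      (cong₂ ℤ._+_ (ℤ.*-identityʳ (ℤ.+ m)) (ℤ.*-identityʳ (ℤ.+ n))))))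

  ℕ→ℚ-nonNeg : ∀ n → NonNegative (ℕ→ℚ n)
  ℕ→ℚ-nonNeg n = normalize-nonNeg n 1

  ℕ→ℚ-mono-≤ : ∀ {m n} → m ℕ.≤ n → ℕ→ℚ m ≤ ℕ→ℚ n
  ℕ→ℚ-mono-≤ {m} {n} m≤n = begin
    ℕ→ℚ m                  ≡⟨ +-identityʳ (ℕ→ℚ m) ⟨
    ℕ→ℚ m + 0ℚ             ≤⟨ +-monoʳ-≤ (ℕ→ℚ m) (nonNegative⁻¹ _ {{ℕ→ℚ-nonNeg (n ℕ.∸ m)}}) ⟩
    ℕ→ℚ m + ℕ→ℚ (n ℕ.∸ m)  ≡⟨ ℕ→ℚ-homo-+ m (n ℕ.∸ m) ⟨
    ℕ→ℚ (m ℕ.+ (n ℕ.∸ m))  ≡⟨ cong ℕ→ℚ (ℕ.m+[n∸m]≡n m≤n) ⟩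
    ℕ→ℚ n                  ∎
    where open ≤-Reasoning

  ℕ→ℚ-cancel-< : ∀ {m n} → ℕ→ℚ m < ℕ→ℚ n → m ℕ.< n
  ℕ→ℚ-cancel-< m<n = ℕ.≰⇒> λ n≤m → <-irrefl refl (<-≤-trans m<n (ℕ→ℚ-mono-≤ n≤m))

  *-monoʳ-≤-ℕ→ℚ : ∀ a {p q} → p ≤ q → p * ℕ→ℚ a ≤ q * ℕ→ℚ a
  *-monoʳ-≤-ℕ→ℚ a = *-monoʳ-≤-nonNeg (ℕ→ℚ a) {{ℕ→ℚ-nonNeg a}}

  +-cancelʳ-≤ : ∀ r {p q} → p + r ≤ q + r → p ≤ q
  +-cancelʳ-≤ r {p} {q} p+r≤q+r = begin
    p           ≡⟨ solve 2 (λ p r → p := (p :+ r) :- r) refl p r ⟩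
    p + r - r   ≤⟨ +-monoˡ-≤ (- r) p+r≤q+r ⟩
    q + r - r   ≡⟨ solve 2 (λ q r → (q :+ r) :- r := q) refl q r ⟩
    q           ∎
    where
    open ≤-Reasoning
    open import Data.Rational.Solver using (module +-*-Solver)
    open +-*-Solver

  *-ℕ→ℚ-distribˡ-+ : ∀ p a r → p * ℕ→ℚ (a ℕ.+ r) ≡ p * ℕ→ℚ a + p * ℕ→ℚ r
  *-ℕ→ℚ-distribˡ-+ p a r = trans (cong (p *_) (ℕ→ℚ-homo-+ a r)) (*-distribˡ-+ p (ℕ→ℚ a) (ℕ→ℚ r))

  ≤∞-trans : ∀ {a b c : ℚ∞} → a ≤∞ b → b ≤∞ c → a ≤∞ c
  ≤∞-trans (fin≤fin p≤q) (fin≤fin q≤r) = fin≤fin (≤-trans p≤q q≤r)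
  ≤∞-trans {a} _         (_ ≤∞top)     = a ≤∞top

module Plans where

  open import Algebra.Bundles using (CommutativeMonoid)
  open import Data.Nat.Base as ℕ using (ℕ; zero; suc; _+_; _≤_; _<_; z≤n)
  import Data.Nat.Properties as ℕ
  open import Data.Sum.Base using (inj₁; inj₂)
  open import Level using (0ℓ)
  open import Relation.Binary.PropositionalEquality using (_≡_; _≢_; refl; trans; cong; ≢-sym; module ≡-Reasoning)
  open import Relation.Nullary.Decidable using (yes; no)
  open import Relation.Nullary.Negation using (contradiction)
  open Preliminaries using (stepwise-monotone)

  infixl 5 _[_]≔_

  _[_]≔_ : Plan → ℕ → ℕ → Plan
  (z [ m ]≔ a) j with j ℕ.≟ m
  ... | yes _ = a
  ... | no  _ = z j

  update-≡ : ∀ z m a → (z [ m ]≔ a) m ≡ a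
  update-≡ z m a with m ℕ.≟ m
  ... | yes _   = refl
  ... | no m≢m = contradiction refl m≢m

  update-≢ : ∀ z {m} a {j} → j ≢ m → (z [ m ]≔ a) j ≡ z j
  update-≢ z {m} a {j} j≢m with j ℕ.≟ m
  ... | yes j≡m = contradiction j≡m j≢m
  ... | no  _   = refl

  update-+-≥ : ∀ z m r j → z j ≤ (z [ m ]≔ z m + r) j
  update-+-≥ z m r j with j ℕ.≟ m
  ... | yes refl = ℕ.m≤m+n (z j) r
  ... | no  _    = ℕ.≤-refl

  Agree : ℕ → Plan → Plan → Set
  Agree t z z′ = ∀ j → j ≤ t → z j ≡ z′ j

  update-agree : ∀ z {m} a {t} → t < m → Agree t (z [ m ]≔ a) z
  update-agree z a t<m j j≤t = update-≢ z a (ℕ.<⇒≢ (ℕ.≤-<-trans j≤t t<m))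

  NoOrdersBetween : ℕ → ℕ → Plan → Set
  NoOrdersBetween m t z = ∀ j → m < j → j ≤ t → z j ≡ 0

  noOrders-≤ : ∀ {m t t′ z} → t ≤ t′ → NoOrdersBetween m t′ z → NoOrdersBetween m t z
  noOrders-≤ t≤t′ idle j m<j j≤t = idle j m<j (ℕ.≤-trans j≤t t≤t′)

  update-noOrders : ∀ {m t y} b → NoOrdersBetween m t y → NoOrdersBetween m t (y [ m ]≔ b)
  update-noOrders b idle j m<j j≤t = trans (update-≢ _ b (ℕ.>⇒≢ m<j)) (idle j m<j j≤t)

  clear-noOrders : ∀ {m t y} → NoOrdersBetween (suc m) t y → NoOrdersBetween m t (y [ suc m ]≔ 0)
  clear-noOrders {m} idle j m<j j≤t with j ℕ.≟ suc m
  ... | yes _     = refl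
  ... | no j≢1+m = idle j (ℕ.≤∧≢⇒< m<j (≢-sym j≢1+m)) j≤t

  module PrefixSum (M : CommutativeMonoid 0ℓ 0ℓ) where

    open CommutativeMonoid M using (Carrier; _≈_; _∙_; ε; ∙-cong; ∙-congʳ; reflexive; setoid; commutativeSemigroup)
    open import Algebra.Properties.CommutativeSemigroup commutativeSemigroup using (xy∙z≈xz∙y)
    open import Relation.Binary.Reasoning.Setoid setoid

    module _ (g : ℕ → ℕ → Carrier) (S : Plan → ℕ → Carrier)
             (S-zero : ∀ z → S z zero ≈ ε)
             (S-suc : ∀ z t → S z (suc t) ≈ S z t ∙ g (suc t) (z (suc t))) where

      sum-cong : ∀ {z z′} t → Agree t z z′ → S z t ≈ S z′ t
      sum-cong {z} {z′} zero _ = begin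
        S z zero   ≈⟨ S-zero z ⟩
        ε          ≈⟨ S-zero z′ ⟨
        S z′ zero  ∎
      sum-cong {z} {z′} (suc t) z≗z′ = begin
        S z (suc t)                      ≈⟨ S-suc z t ⟩
        S z t ∙ g (suc t) (z (suc t))    ≈⟨ ∙-cong (sum-cong t λ j j≤t → z≗z′ j (ℕ.m≤n⇒m≤1+n j≤t))
                                                   (reflexive (cong (g (suc t)) (z≗z′ (suc t) ℕ.≤-refl))) ⟩
        S z′ t ∙ g (suc t) (z′ (suc t))  ≈⟨ S-suc z′ t ⟨
        S z′ (suc t)                     ∎

      sum-update : ∀ z {m} a t → 1 ≤ m → m ≤ t → S (z [ m ]≔ a) t ∙ g m (z m) ≈ S z t ∙ g m a
      sum-update z {suc _} a zero _ ()
      sum-update z {m} a (suc t) 1≤m m≤1+t with ℕ.m≤n⇒m<n∨m≡n m≤1+t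
      ... | inj₂ refl = begin
        S z′ (suc t) ∙ g m (z m)                    ≈⟨ ∙-congʳ (S-suc z′ t) ⟩
        S z′ t ∙ g m (z′ m) ∙ g m (z m)             ≈⟨ ∙-congʳ (∙-cong (sum-cong t (update-agree z a (ℕ.n<1+n t)))
                                                                         (reflexive (cong (g m) (update-≡ z m a)))) ⟩
        S z t ∙ g m a ∙ g m (z m)                   ≈⟨ xy∙z≈xz∙y _ _ _ ⟩
        S z t ∙ g m (z m) ∙ g m a                   ≈⟨ ∙-congʳ (S-suc z t) ⟨
        S z (suc t) ∙ g m a                         ∎
        where z′ = z [ m ]≔ a
      ... | inj₁ m<1+t = begin
        S z′ (suc t) ∙ g m (z m)                    ≈⟨ ∙-congʳ (S-suc z′ t) ⟩
        S z′ t ∙ g (suc t) (z′ (suc t)) ∙ g m (z m) ≈⟨ xy∙z≈xz∙y _ _ _ ⟩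
        S z′ t ∙ g m (z m) ∙ g (suc t) (z′ (suc t)) ≈⟨ ∙-cong (sum-update z a t 1≤m (ℕ.≤-pred m<1+t))
                                                               (reflexive (cong (g (suc t)) (update-≢ z a (ℕ.>⇒≢ m<1+t)))) ⟩
        S z t ∙ g m a ∙ g (suc t) (z (suc t))       ≈⟨ xy∙z≈xz∙y _ _ _ ⟩
        S z t ∙ g (suc t) (z (suc t)) ∙ g m a       ≈⟨ ∙-congʳ (S-suc z t) ⟨
        S z (suc t) ∙ g m a                         ∎
        where z′ = z [ m ]≔ a

  ordered : Plan → ℕ → ℕ
  ordered z zero    = 0
  ordered z (suc t) = ordered z t + z (suc t)

  ordered-cong : ∀ {z z′} t → Agree t z z′ → ordered z t ≡ ordered z′ t
  ordered-cong = PrefixSum.sum-cong ℕ.+-0-commutativeMonoid (λ _ a → a) ordered (λ _ → refl) (λ _ _ → refl)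

  ordered-update : ∀ z {m} a t → 1 ≤ m → m ≤ t → ordered (z [ m ]≔ a) t + z m ≡ ordered z t + a
  ordered-update = PrefixSum.sum-update ℕ.+-0-commutativeMonoid (λ _ a → a) ordered (λ _ → refl) (λ _ _ → refl)

  ordered-add : ∀ z {m} r {t} → 1 ≤ m → m ≤ t → ordered (z [ m ]≔ z m + r) t ≡ ordered z t + r
  ordered-add z {m} r {t} 1≤m m≤t = ℕ.+-cancelʳ-≡ (z m) _ _ (begin
    ordered (z [ m ]≔ z m + r) t + z m  ≡⟨ ordered-update z (z m + r) t 1≤m m≤t ⟩
    ordered z t + (z m + r)            ≡⟨ cong (ordered z t +_) (ℕ.+-comm (z m) r) ⟩
    ordered z t + (r + z m)            ≡⟨ ℕ.+-assoc (ordered z t) r (z m) ⟨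
    ordered z t + r + z m              ∎)
    where open ≡-Reasoning

  ordered-split : ∀ z {m} b r {t} → 1 ≤ m → m ≤ t → b + r ≡ z m → ordered z t ≡ ordered (z [ m ]≔ b) t + r
  ordered-split z {m} b r {t} 1≤m m≤t b+r≡zm = ℕ.+-cancelʳ-≡ b _ _ (begin
    ordered z t + b                    ≡⟨ ordered-update z b t 1≤m m≤t ⟨
    ordered (z [ m ]≔ b) t + z m       ≡⟨ cong (ordered (z [ m ]≔ b) t +_) b+r≡zm ⟨
    ordered (z [ m ]≔ b) t + (b + r)   ≡⟨ cong (ordered (z [ m ]≔ b) t +_) (ℕ.+-comm b r) ⟩
    ordered (z [ m ]≔ b) t + (r + b)   ≡⟨ ℕ.+-assoc (ordered (z [ m ]≔ b) t) r b ⟨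
    ordered (z [ m ]≔ b) t + r + b     ∎)
    where open ≡-Reasoning

  ordered-mono : ∀ z {t t′} → t ≤ t′ → ordered z t ≤ ordered z t′
  ordered-mono z = stepwise-monotone _≤_ ℕ.≤-refl ℕ.≤-trans (ordered z) (λ t → ℕ.m≤m+n _ _)

  ordered-mono-pointwise : ∀ {z z′} t → (∀ j → z j ≤ z′ j) → ordered z t ≤ ordered z′ t
  ordered-mono-pointwise zero    _     = z≤n
  ordered-mono-pointwise (suc t) z≤z′ = ℕ.+-mono-≤ (ordered-mono-pointwise t z≤z′) (z≤z′ (suc t))

  ordered[t]+z[s]≤ordered[t′] : ∀ z {t s t′} → t < s → s ≤ t′ → ordered z t + z s ≤ ordered z t′
  ordered[t]+z[s]≤ordered[t′] z {s = suc s} t<1+s 1+s≤t′ =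
    ℕ.≤-trans (ℕ.+-monoˡ-≤ (z (suc s)) (ordered-mono z (ℕ.≤-pred t<1+s))) (ordered-mono z 1+s≤t′)

  ordered-constant : ∀ z {m t} → m ≤ t → NoOrdersBetween m t z → ordered z t ≡ ordered z m
  ordered-constant z {m} {zero}  z≤n   _    = refl
  ordered-constant z {m} {suc t} m≤1+t idle with ℕ.m≤n⇒m<n∨m≡n m≤1+t
  ... | inj₂ refl   = refl
  ... | inj₁ m<1+t = begin
    ordered z t + z (suc t)  ≡⟨ cong (ordered z t +_) (idle (suc t) m<1+t ℕ.≤-refl) ⟩
    ordered z t + 0          ≡⟨ ℕ.+-identityʳ _ ⟩
    ordered z t              ≡⟨ ordered-constant z (ℕ.≤-pred m<1+t) (λ j m<j j≤t → idle j m<j (ℕ.m≤n⇒m≤1+n j≤t)) ⟩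
    ordered z m              ∎
    where open ≡-Reasoning

module LotSizing (P : Instance) where

  open Instance P
  open import Algebra.Bundles using (CommutativeMonoid)
  open import Data.Bool.Base using (if_then_else_)
  open import Data.Maybe.Base using (just)
  open import Data.Maybe.Properties using (just-injective)
  open import Data.Nat.Base as ℕ using (ℕ; zero; suc; z≤n; s≤s)
  import Data.Nat.Properties as ℕ
  open import Data.Product.Base using (Σ; _×_; _,_)
  open import Data.Rational.Base hiding (floor)
  open import Data.Rational.Properties
  open import Function.Base using (flip; case_of_)
  open import Relation.Binary.PropositionalEquality
  open import Relation.Nullary.Decidable using (yes; no; ⌊_⌋)
  open import Relation.Nullary.Negation using (¬_; contradiction)
  open import Algebra.Properties.CommutativeSemigroup
    (CommutativeMonoid.commutativeSemigroup +-0-commutativeMonoid) using (x∙yz≈xz∙y; xy∙z≈x∙zy)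
  open Preliminaries
  open Plans

  p₁-antitone : ∀ {m t} → m ℕ.≤ t → p₁ t ≤ p₁ m
  p₁-antitone = stepwise-monotone _≥_ ≤-refl (flip ≤-trans) p₁ p₁-mono

  p₂-antitone : ∀ {m t} → m ℕ.≤ t → p₂ t ≤ p₂ m
  p₂-antitone = stepwise-monotone _≥_ ≤-refl (flip ≤-trans) p₂ p₂-mono

  demanded : ℕ → ℚ
  demanded zero    = 0ℚ
  demanded (suc t) = demanded t + d (suc t)

  demanded-mono : ∀ {t t′} → t ℕ.≤ t′ → demanded t ≤ demanded t′
  demanded-mono = stepwise-monotone _≤_ ≤-refl ≤-trans demanded λ t → begin
    demanded t               ≡⟨ +-identityʳ (demanded t) ⟨
    demanded t + 0ℚ          ≤⟨ +-monoʳ-≤ (demanded t) (d≥0 (suc t)) ⟩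
    demanded t + d (suc t)   ∎
    where open ≤-Reasoning

  inv-ordered : ∀ z t → inv P z t ≡ ℕ→ℚ (ordered z t) - demanded t
  inv-ordered z zero    = refl
  inv-ordered z (suc t) = begin
    inv P z t + ℕ→ℚ (z (suc t)) - d (suc t)
      ≡⟨ cong (λ i → i + ℕ→ℚ (z (suc t)) - d (suc t)) (inv-ordered z t) ⟩
    ℕ→ℚ (ordered z t) - demanded t + ℕ→ℚ (z (suc t)) - d (suc t)
      ≡⟨ solve 4 (λ o D a e → o :- D :+ a :- e := (o :+ a) :- (D :+ e)) refl
                 (ℕ→ℚ (ordered z t)) (demanded t) (ℕ→ℚ (z (suc t))) (d (suc t)) ⟩
    ℕ→ℚ (ordered z t) + ℕ→ℚ (z (suc t)) - demanded (suc t)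
      ≡⟨ cong (_- demanded (suc t)) (ℕ→ℚ-homo-+ (ordered z t) (z (suc t))) ⟨
    ℕ→ℚ (ordered z (suc t)) - demanded (suc t)
      ∎
    where
    open ≡-Reasoning
    open import Data.Rational.Solver using (module +-*-Solver)
    open +-*-Solver

  inv-mono : ∀ z z′ t → ordered z t ℕ.≤ ordered z′ t → inv P z t ≤ inv P z′ t
  inv-mono z z′ t o≤o′ = subst₂ _≤_ (sym (inv-ordered z t)) (sym (inv-ordered z′ t))
    (+-monoˡ-≤ (- demanded t) (ℕ→ℚ-mono-≤ o≤o′))

  inv-cong : ∀ z z′ t → ordered z t ≡ ordered z′ t → inv P z t ≡ inv P z′ t
  inv-cong z z′ t o≡o′ = begin
    inv P z t                     ≡⟨ inv-ordered z t ⟩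
    ℕ→ℚ (ordered z t) - demanded t  ≡⟨ cong (λ o → ℕ→ℚ o - demanded t) o≡o′ ⟩
    ℕ→ℚ (ordered z′ t) - demanded t ≡⟨ inv-ordered z′ t ⟨
    inv P z′ t                    ∎
    where open ≡-Reasoning

  inv-antitone : ∀ z {t t′} → t ℕ.≤ t′ → ordered z t ≡ ordered z t′ → inv P z t′ ≤ inv P z t
  inv-antitone z {t} {t′} t≤t′ same = begin
    inv P z t′                       ≡⟨ inv-ordered z t′ ⟩
    ℕ→ℚ (ordered z t′) - demanded t′  ≡⟨ cong (λ o → ℕ→ℚ o - demanded t′) same ⟨
    ℕ→ℚ (ordered z t) - demanded t′   ≤⟨ +-monoʳ-≤ (ℕ→ℚ (ordered z t)) (neg-antimono-≤ (demanded-mono t≤t′)) ⟩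
    ℕ→ℚ (ordered z t) - demanded t    ≡⟨ inv-ordered z t ⟨
    inv P z t                        ∎
    where open ≤-Reasoning

  inv-update-< : ∀ z {m} a {t} → t ℕ.< m → inv P (z [ m ]≔ a) t ≡ inv P z t
  inv-update-< z a {t} t<m = inv-cong (z [ _ ]≔ a) z t (ordered-cong t (update-agree z a t<m))

  Feasible : ℕ → Plan → Set
  Feasible n z = ∀ t → t ℕ.≤ n → 0ℚ ≤ inv P z t

  feasible-add : ∀ {n z} j r → Feasible n z → Feasible n (z [ j ]≔ z j ℕ.+ r)
  feasible-add {z = z} j r fz t t≤n =
    ≤-trans (fz t t≤n) (inv-mono z _ t (ordered-mono-pointwise t (update-+-≥ z j r)))

  feasible-without-late-orders : ∀ {n M z} → M ℕ.≤ n → (∀ t → t ℕ.< M → 0ℚ ≤ inv P z t) →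
                                 NoOrdersBetween M n z → 0ℚ ≤ inv P z n → Feasible n z
  feasible-without-late-orders {M = M} {z} M≤n early idle final t t≤n with t ℕ.<? M
  ... | yes t<M = early t t<M
  ... | no  t≮M = ≤-trans final (inv-antitone z t≤n (trans (ordered-constant z (ℕ.≮⇒≥ t≮M) (noOrders-≤ t≤n idle))
                                                            (sym (ordered-constant z M≤n idle))))

  purchase-discounted : ∀ t a → Q ≤ ℕ→ℚ a → purchase P t a ≡ p₂ t * ℕ→ℚ a
  purchase-discounted t a Q≤a with Q ≤? ℕ→ℚ a
  ... | yes _   = refl
  ... | no Q≰a = contradiction Q≤a Q≰a

  purchase-regular : ∀ t a → ¬ Q ≤ ℕ→ℚ a → purchase P t a ≡ p₁ t * ℕ→ℚ a
  purchase-regular t a Q≰a with Q ≤? ℕ→ℚ a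
  ... | yes Q≤a = contradiction Q≤a Q≰a
  ... | no _    = refl

  Q≰0 : ¬ Q ≤ ℕ→ℚ 0
  Q≰0 Q≤0 = <-irrefl refl (<-≤-trans Q>0 Q≤0)

  purchase-zero : ∀ t → purchase P t 0 ≡ 0ℚ
  purchase-zero t = trans (purchase-regular t 0 Q≰0) (*-zeroʳ (p₁ t))

  purchase-antitone : ∀ {m t} a → m ℕ.≤ t → purchase P t a ≤ purchase P m a
  purchase-antitone a m≤t with Q ≤? ℕ→ℚ a
  ... | yes _ = *-monoʳ-≤-ℕ→ℚ a (p₂-antitone m≤t)
  ... | no  _ = *-monoʳ-≤-ℕ→ℚ a (p₁-antitone m≤t)

  purchase-+-discounted : ∀ t a r → Q ≤ ℕ→ℚ a → purchase P t (a ℕ.+ r) ≡ purchase P t a + p₂ t * ℕ→ℚ r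
  purchase-+-discounted t a r Q≤a = begin
    purchase P t (a ℕ.+ r)         ≡⟨ purchase-discounted t (a ℕ.+ r) (≤-trans Q≤a (ℕ→ℚ-mono-≤ (ℕ.m≤m+n a r))) ⟩
    p₂ t * ℕ→ℚ (a ℕ.+ r)          ≡⟨ *-ℕ→ℚ-distribˡ-+ (p₂ t) a r ⟩
    p₂ t * ℕ→ℚ a + p₂ t * ℕ→ℚ r   ≡⟨ cong (_+ p₂ t * ℕ→ℚ r) (purchase-discounted t a Q≤a) ⟨
    purchase P t a + p₂ t * ℕ→ℚ r  ∎
    where open ≡-Reasoning

  purchase-+-regular : ∀ t a r → ¬ Q ≤ ℕ→ℚ (a ℕ.+ r) → purchase P t (a ℕ.+ r) ≡ purchase P t a + p₁ t * ℕ→ℚ r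
  purchase-+-regular t a r Q≰a+r = begin
    purchase P t (a ℕ.+ r)         ≡⟨ purchase-regular t (a ℕ.+ r) Q≰a+r ⟩
    p₁ t * ℕ→ℚ (a ℕ.+ r)          ≡⟨ *-ℕ→ℚ-distribˡ-+ (p₁ t) a r ⟩
    p₁ t * ℕ→ℚ a + p₁ t * ℕ→ℚ r   ≡⟨ cong (_+ p₁ t * ℕ→ℚ r) (purchase-regular t a Q≰a) ⟨
    purchase P t a + p₁ t * ℕ→ℚ r  ∎
    where
    open ≡-Reasoning
    Q≰a : ¬ Q ≤ ℕ→ℚ a
    Q≰a Q≤a = Q≰a+r (≤-trans Q≤a (ℕ→ℚ-mono-≤ (ℕ.m≤m+n a r)))

  discounted-cost≤purchase : ∀ t a → p₂ t * ℕ→ℚ a ≤ purchase P t a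
  discounted-cost≤purchase t a with Q ≤? ℕ→ℚ a
  ... | yes _ = ≤-refl
  ... | no  _ = *-monoʳ-≤-ℕ→ℚ a (p₂≤p₁ t)

  purchase-+-≤ : ∀ t a r → purchase P t (a ℕ.+ r) ≤ purchase P t a + p₁ t * ℕ→ℚ r
  purchase-+-≤ t a r = case Q ≤? ℕ→ℚ (a ℕ.+ r) of λ where
      (no Q≰a+r)  → ≤-reflexive (purchase-+-regular t a r Q≰a+r)
      (yes Q≤a+r) → begin
        purchase P t (a ℕ.+ r)         ≡⟨ purchase-discounted t (a ℕ.+ r) Q≤a+r ⟩
        p₂ t * ℕ→ℚ (a ℕ.+ r)          ≡⟨ *-ℕ→ℚ-distribˡ-+ (p₂ t) a r ⟩
        p₂ t * ℕ→ℚ a + p₂ t * ℕ→ℚ r   ≤⟨ +-mono-≤ (discounted-cost≤purchase t a) (*-monoʳ-≤-ℕ→ℚ r (p₂≤p₁ t)) ⟩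
        purchase P t a + p₁ t * ℕ→ℚ r  ∎
    where open ≤-Reasoning

  exchange-discounted : ∀ {M j} a b r → M ℕ.≤ j → Q ≤ ℕ→ℚ a → Q ≤ ℕ→ℚ b →
    purchase P j (a ℕ.+ r) + purchase P M b ≤ purchase P j a + purchase P M (b ℕ.+ r)
  exchange-discounted {M} {j} a b r M≤j Q≤a Q≤b = begin
    purchase P j (a ℕ.+ r) + Pb                 ≡⟨ cong (_+ Pb) (purchase-+-discounted j a r Q≤a) ⟩
    Pa + p₂ j * ℕ→ℚ r + Pb                      ≤⟨ +-monoˡ-≤ Pb (+-monoʳ-≤ Pa (*-monoʳ-≤-ℕ→ℚ r (p₂-antitone M≤j))) ⟩
    Pa + p₂ M * ℕ→ℚ r + Pb                      ≡⟨ xy∙z≈x∙zy Pa (p₂ M * ℕ→ℚ r) Pb ⟩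
    Pa + (Pb + p₂ M * ℕ→ℚ r)                    ≡⟨ cong (Pa +_) (purchase-+-discounted M b r Q≤b) ⟨
    Pa + purchase P M (b ℕ.+ r)                 ∎
    where
    open ≤-Reasoning
    Pa = purchase P j a
    Pb = purchase P M b

  exchange-regular : ∀ {M j} a b r → M ℕ.≤ j → ¬ Q ≤ ℕ→ℚ (b ℕ.+ r) →
    purchase P j (a ℕ.+ r) + purchase P M b ≤ purchase P j a + purchase P M (b ℕ.+ r)
  exchange-regular {M} {j} a b r M≤j Q≰b+r = begin
    purchase P j (a ℕ.+ r) + Pb                 ≤⟨ +-monoˡ-≤ Pb (purchase-+-≤ j a r) ⟩
    Pa + p₁ j * ℕ→ℚ r + Pb                      ≤⟨ +-monoˡ-≤ Pb (+-monoʳ-≤ Pa (*-monoʳ-≤-ℕ→ℚ r (p₁-antitone M≤j))) ⟩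
    Pa + p₁ M * ℕ→ℚ r + Pb                      ≡⟨ xy∙z≈x∙zy Pa (p₁ M * ℕ→ℚ r) Pb ⟩
    Pa + (Pb + p₁ M * ℕ→ℚ r)                    ≡⟨ cong (Pa +_) (purchase-+-regular M b r Q≰b+r) ⟨
    Pa + purchase P M (b ℕ.+ r)                 ∎
    where
    open ≤-Reasoning
    Pa = purchase P j a
    Pb = purchase P M b

  exchange-whole-order : ∀ {M j} r → M ℕ.≤ j →
                         purchase P j r + purchase P M 0 ≤ purchase P j 0 + purchase P M r
  exchange-whole-order {M} {j} r M≤j = begin
    purchase P j r + purchase P M 0  ≡⟨ cong (purchase P j r +_) (purchase-zero M) ⟩
    purchase P j r + 0ℚ              ≡⟨ +-identityʳ (purchase P j r) ⟩
    purchase P j r                   ≤⟨ purchase-antitone r M≤j ⟩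
    purchase P M r                   ≡⟨ +-identityˡ (purchase P M r) ⟨
    0ℚ + purchase P M r              ≡⟨ cong (_+ purchase P M r) (purchase-zero j) ⟨
    purchase P j 0 + purchase P M r  ∎
    where open ≤-Reasoning

  cost-update : ∀ z {m} a t → 1 ℕ.≤ m → m ℕ.≤ t →
                cost P (z [ m ]≔ a) t + purchase P m (z m) ≡ cost P z t + purchase P m a
  cost-update = PrefixSum.sum-update +-0-commutativeMonoid (purchase P) (cost P) (λ _ → refl) (λ _ _ → refl)

  transfer-ordered : ∀ {t M j y b r} u → 1 ℕ.≤ M → M ℕ.≤ t → 1 ℕ.≤ j → j ℕ.≤ t → b ℕ.+ r ≡ y M →
    ordered u t ≡ ordered (y [ M ]≔ b) t → ordered (u [ j ]≔ u j ℕ.+ r) t ≡ ordered y t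
  transfer-ordered {t} {M} {j} {y} {b} {r} u 1≤M M≤t 1≤j j≤t b+r≡yM same = begin
    ordered (u [ j ]≔ u j ℕ.+ r) t  ≡⟨ ordered-add u r 1≤j j≤t ⟩
    ordered u t ℕ.+ r              ≡⟨ cong (ℕ._+ r) same ⟩
    ordered (y [ M ]≔ b) t ℕ.+ r   ≡⟨ ordered-split y b r 1≤M M≤t b+r≡yM ⟨
    ordered y t                    ∎
    where open ≡-Reasoning

  transfer-cost : ∀ {t M j y b r} u → 1 ℕ.≤ M → M ℕ.≤ t → 1 ℕ.≤ j → j ℕ.≤ t → b ℕ.+ r ≡ y M →
    cost P u t ≤ cost P (y [ M ]≔ b) t →
    purchase P j (u j ℕ.+ r) + purchase P M b ≤ purchase P j (u j) + purchase P M (b ℕ.+ r) →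
    cost P (u [ j ]≔ u j ℕ.+ r) t ≤ cost P y t
  transfer-cost {t} {M} {j} {y} {b} {r} u 1≤M M≤t 1≤j j≤t b+r≡yM cheaper exchange =
    +-cancelʳ-≤ (uⱼ + purchase P M b) (begin
      cost P u′ t + (uⱼ + purchase P M b)      ≡⟨ +-assoc (cost P u′ t) uⱼ (purchase P M b) ⟨
      cost P u′ t + uⱼ + purchase P M b        ≡⟨ cong (_+ purchase P M b) (cost-update u (u j ℕ.+ r) t 1≤j j≤t) ⟩
      cost P u t + u′ⱼ + purchase P M b        ≡⟨ +-assoc (cost P u t) u′ⱼ (purchase P M b) ⟩
      cost P u t + (u′ⱼ + purchase P M b)      ≤⟨ +-mono-≤ cheaper exchange ⟩
      cost P v t + (uⱼ + purchase P M (b ℕ.+ r)) ≡⟨ cong (λ a → cost P v t + (uⱼ + purchase P M a)) b+r≡yM ⟩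
      cost P v t + (uⱼ + purchase P M (y M))   ≡⟨ x∙yz≈xz∙y (cost P v t) uⱼ (purchase P M (y M)) ⟩
      cost P v t + purchase P M (y M) + uⱼ     ≡⟨ cong (_+ uⱼ) (cost-update y b t 1≤M M≤t) ⟩
      cost P y t + purchase P M b + uⱼ         ≡⟨ xy∙z≈x∙zy (cost P y t) (purchase P M b) uⱼ ⟩
      cost P y t + (uⱼ + purchase P M b)       ∎)
    where
    open ≤-Reasoning
    u′ = u [ j ]≔ u j ℕ.+ r
    v = y [ M ]≔ b
    uⱼ = purchase P j (u j)
    u′ⱼ = purchase P j (u j ℕ.+ r)

  lastPrice-cong : ∀ {z z′} t → Agree t z z′ → lastPrice P z t ≡ lastPrice P z′ t
  lastPrice-cong zero    _     = refl
  lastPrice-cong (suc t) z≗z′ =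
    cong₂ (λ a l → if ⌊ Q ≤? ℕ→ℚ a ⌋ then just (p₂ (suc t)) else l)
          (z≗z′ (suc t) ℕ.≤-refl)
          (lastPrice-cong t λ j j≤t → z≗z′ j (ℕ.m≤n⇒m≤1+n j≤t))

  lastPrice-discounted : ∀ z {t} → Q ≤ ℕ→ℚ (z (suc t)) → lastPrice P z (suc t) ≡ just (p₂ (suc t))
  lastPrice-discounted z {t} Q≤z with Q ≤? ℕ→ℚ (z (suc t))
  ... | yes _   = refl
  ... | no Q≰z = contradiction Q≤z Q≰z

  lastPrice-regular : ∀ z {t} → ¬ Q ≤ ℕ→ℚ (z (suc t)) → lastPrice P z (suc t) ≡ lastPrice P z t
  lastPrice-regular z {t} Q≰z with Q ≤? ℕ→ℚ (z (suc t))
  ... | yes Q≤z = contradiction Q≤z Q≰z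
  ... | no  _   = refl

  lastPrice-≤-discounted : ∀ z {s t} → 1 ℕ.≤ s → s ℕ.≤ t → Q ≤ ℕ→ℚ (z s) → lastPrice P z t ≤∞ just (p₂ s)
  lastPrice-≤-discounted z {t = zero} (s≤s _) ()
  lastPrice-≤-discounted z {t = suc t} 1≤s s≤1+t Q≤zs with Q ≤? ℕ→ℚ (z (suc t))
  ... | yes _   = fin≤fin (p₂-antitone s≤1+t)
  ... | no Q≰z = lastPrice-≤-discounted z 1≤s (ℕ.≤-pred (ℕ.≤∧≢⇒< s≤1+t λ { refl → Q≰z Q≤zs })) Q≤zs

  lastPrice-just : ∀ z {t q} → lastPrice P z t ≡ just q →
                   Σ ℕ λ s → 1 ℕ.≤ s × s ℕ.≤ t × Q ≤ ℕ→ℚ (z s) × p₂ s ≡ q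
  lastPrice-just z {suc t} last with Q ≤? ℕ→ℚ (z (suc t))
  ... | yes Q≤z = suc t , s≤s z≤n , ℕ.≤-refl , Q≤z , just-injective last
  ... | no  _ with lastPrice-just z last
  ...   | s , 1≤s , s≤t , Q≤zs , p₂s≡q = s , 1≤s , ℕ.m≤n⇒m≤1+n s≤t , Q≤zs , p₂s≡q

  lastPrice-add-last : ∀ z {t q} r → lastPrice P z t ≤∞ just q → p₂ t ≤ q →
                       lastPrice P (z [ t ]≔ z t ℕ.+ r) t ≤∞ just q
  lastPrice-add-last z {zero}      r last _    = last
  lastPrice-add-last z {suc t} {q} r last p₂≤q = case Q ≤? ℕ→ℚ (u (suc t)) of λ where
      (yes Q≤u) → subst (_≤∞ just q) (sym (lastPrice-discounted u Q≤u)) (fin≤fin p₂≤q)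
      (no Q≰u)  → subst (_≤∞ just q) (trans (earlier Q≰u) (sym (lastPrice-regular u Q≰u))) last
    where
    u = z [ suc t ]≔ z (suc t) ℕ.+ r
    earlier : ¬ Q ≤ ℕ→ℚ (u (suc t)) → lastPrice P z (suc t) ≡ lastPrice P u t
    earlier Q≰u = trans (lastPrice-regular z λ Q≤z → Q≰u (≤-trans Q≤z (ℕ→ℚ-mono-≤ (update-+-≥ z (suc t) r (suc t)))))
                        (sym (lastPrice-cong t (update-agree z _ (ℕ.n<1+n t))))

  module Exchange
    (n : ℕ) (x : Plan) (s : ℕ)
    (x-feasible : Feasible n x)
    (x-optimal : ∀ z → Feasible n z → ordered z n ≡ ordered x n → cost P x n ≤ cost P z n)
    (1≤s : 1 ℕ.≤ s) (s≤n : s ℕ.≤ n) (Q≤xs : Q ≤ ℕ→ℚ (x s))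
    where

    record Replacement (y : Plan) : Set where
      field
        plan          : Plan
        feasible      : Feasible n plan
        same-total    : ordered plan n ≡ ordered y n
        cheaper       : cost P plan n ≤ cost P y n
        late-discount : lastPrice P plan n ≤∞ just (p₂ s)

    x-replaces : ∀ {y} → Feasible n y → ordered y n ≡ ordered x n → Replacement y
    x-replaces fy same = record
      { plan          = x
      ; feasible      = x-feasible
      ; same-total    = sym same
      ; cheaper       = x-optimal _ fy same
      ; late-discount = lastPrice-≤-discounted x 1≤s s≤n Q≤xs
      }

    self-replaces : ∀ {y} → Feasible n y → lastPrice P y n ≤∞ just (p₂ s) → Replacement y
    self-replaces {y} fy late = record
      { plan = y ; feasible = fy ; same-total = refl ; cheaper = ≤-refl ; late-discount = late }

    transfer : ∀ {M j y b r} → 1 ℕ.≤ M → M ℕ.≤ n → 1 ℕ.≤ j → j ℕ.≤ n → b ℕ.+ r ≡ y M →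
               (R : Replacement (y [ M ]≔ b)) → let u = Replacement.plan R in
               purchase P j (u j ℕ.+ r) + purchase P M b ≤ purchase P j (u j) + purchase P M (b ℕ.+ r) →
               lastPrice P (u [ j ]≔ u j ℕ.+ r) n ≤∞ just (p₂ s) →
               Replacement y
    transfer {j = j} {r = r} 1≤M M≤n 1≤j j≤n b+r≡yM R exchange late = record
      { plan          = plan [ j ]≔ plan j ℕ.+ r
      ; feasible      = feasible-add j r feasible
      ; same-total    = transfer-ordered plan 1≤M M≤n 1≤j j≤n b+r≡yM same-total
      ; cheaper       = transfer-cost plan 1≤M M≤n 1≤j j≤n b+r≡yM cheaper exchange
      ; late-discount = late
      }
      where open Replacement R

    transfer-to-last-period : ∀ {M y b r} → 1 ℕ.≤ M → M ℕ.≤ n → ¬ Q ≤ ℕ→ℚ (y M) → b ℕ.+ r ≡ y M →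
                              Replacement (y [ M ]≔ b) → Replacement y
    transfer-to-last-period {b = b} {r} 1≤M M≤n Q≰yM b+r≡yM R =
      transfer 1≤M M≤n (ℕ.≤-trans 1≤M M≤n) ℕ.≤-refl b+r≡yM R
        (exchange-regular (plan n) b r M≤n (subst (λ a → ¬ Q ≤ ℕ→ℚ a) (sym b+r≡yM) Q≰yM))
        (lastPrice-add-last plan r late-discount (p₂-antitone s≤n))
      where open Replacement R

    module Surplus {m y} (M≤n : suc m ℕ.≤ n) (fy : Feasible n y) (idle : NoOrdersBetween (suc m) n y)
                   (x<y : ordered x n ℕ.< ordered y n) where

      M : ℕ
      M = suc m

      1≤M : 1 ℕ.≤ M
      1≤M = s≤s z≤n

      k : ℕ
      k = ordered y n ℕ.∸ ordered x n

      surplus : ordered y n ≡ ordered x n ℕ.+ k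
      surplus = sym (ℕ.m+[n∸m]≡n (ℕ.<⇒≤ x<y))

      cleared : Plan
      cleared = y [ M ]≔ 0

      trimmed-feasible : ∀ b → ordered x n ℕ.≤ ordered (y [ M ]≔ b) n → Feasible n (y [ M ]≔ b)
      trimmed-feasible b x≤v = feasible-without-late-orders M≤n
        (λ t t<M → subst (0ℚ ≤_) (sym (inv-update-< y b t<M)) (fy t (ℕ.≤-trans (ℕ.<⇒≤ t<M) M≤n)))
        (update-noOrders b idle)
        (≤-trans (x-feasible n ℕ.≤-refl) (inv-mono x (y [ M ]≔ b) n x≤v))

      x-replaces-trimmed : k ℕ.≤ y M → Replacement (y [ M ]≔ y M ℕ.∸ k)
      x-replaces-trimmed k≤yM = x-replaces (trimmed-feasible _ (ℕ.≤-reflexive (sym same))) same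
        where
        same : ordered (y [ M ]≔ y M ℕ.∸ k) n ≡ ordered x n
        same = ℕ.+-cancelʳ-≡ k _ _ (trans (sym (ordered-split y (y M ℕ.∸ k) k 1≤M M≤n (ℕ.m∸n+n≡m k≤yM))) surplus)

      surplus-to-discount-period : M ℕ.≤ s → Q ≤ ℕ→ℚ (y M ℕ.∸ k) → Replacement y
      surplus-to-discount-period M≤s Q≤rest =
        transfer 1≤M M≤n 1≤s s≤n (ℕ.m∸n+n≡m k≤yM) (x-replaces-trimmed k≤yM)
          (exchange-discounted (x s) (y M ℕ.∸ k) k M≤s Q≤xs Q≤rest)
          (lastPrice-≤-discounted _ 1≤s s≤n (subst (λ a → Q ≤ ℕ→ℚ a) (sym (update-≡ x s _))
            (≤-trans Q≤xs (ℕ→ℚ-mono-≤ (ℕ.m≤m+n (x s) k)))))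
        where
        k≤yM : k ℕ.≤ y M
        k≤yM = ℕ.≮⇒≥ λ yM<k → Q≰0 (subst (λ a → Q ≤ ℕ→ℚ a) (ℕ.m≤n⇒m∸n≡0 (ℕ.<⇒≤ yM<k)) Q≤rest)

      -- Between M and s the units taken from period M are covered by x's order at s > y_M − k.
      ordered-x≤cleared-before-s : ¬ Q ≤ ℕ→ℚ (y M ℕ.∸ k) → ∀ {t} → M ℕ.≤ t → t ℕ.< s →
                                   ordered x t ℕ.≤ ordered cleared t
      ordered-x≤cleared-before-s Q≰rest {t} M≤t t<s = ℕ.+-cancelʳ-≤ (y M) _ _ (begin
        ordered x t ℕ.+ y M            ≤⟨ ℕ.+-monoʳ-≤ (ordered x t) yM≤k+xs ⟩
        ordered x t ℕ.+ (k ℕ.+ x s)    ≡⟨ cong (ordered x t ℕ.+_) (ℕ.+-comm k (x s)) ⟩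
        ordered x t ℕ.+ (x s ℕ.+ k)    ≡⟨ ℕ.+-assoc (ordered x t) (x s) k ⟨
        ordered x t ℕ.+ x s ℕ.+ k      ≤⟨ ℕ.+-monoˡ-≤ k (ordered[t]+z[s]≤ordered[t′] x t<s s≤n) ⟩
        ordered x n ℕ.+ k              ≡⟨ surplus ⟨
        ordered y n                    ≡⟨ ordered-constant y M≤n idle ⟩
        ordered y M                    ≡⟨ ordered-constant y M≤t (noOrders-≤ t≤n idle) ⟨
        ordered y t                    ≡⟨ ordered-split y 0 (y M) 1≤M M≤t refl ⟩
        ordered cleared t ℕ.+ y M      ∎)
        where
        open ℕ.≤-Reasoning
        t≤n = ℕ.≤-trans (ℕ.<⇒≤ t<s) s≤n
        yM≤k+xs : y M ℕ.≤ k ℕ.+ x s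
        yM≤k+xs = ℕ.≤-trans (ℕ.m≤n+m∸n (y M) k)
          (ℕ.+-monoʳ-≤ k (ℕ.<⇒≤ (ℕ→ℚ-cancel-< (<-≤-trans (≰⇒> Q≰rest) Q≤xs))))

      cleared-feasible-before-s : ¬ Q ≤ ℕ→ℚ (y M ℕ.∸ k) → ∀ t → t ℕ.< s → 0ℚ ≤ inv P cleared t
      cleared-feasible-before-s Q≰rest t t<s = case t ℕ.<? M of λ where
          (yes t<M) → subst (0ℚ ≤_) (sym (inv-update-< y 0 t<M)) (fy t t≤n)
          (no t≮M)  → ≤-trans (x-feasible t t≤n)
                                (inv-mono x cleared t (ordered-x≤cleared-before-s Q≰rest (ℕ.≮⇒≥ t≮M) t<s))
        where t≤n = ℕ.≤-trans (ℕ.<⇒≤ t<s) s≤n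

      order-to-discount-period : M ℕ.< s → Q ≤ ℕ→ℚ (y M) → ¬ Q ≤ ℕ→ℚ (y M ℕ.∸ k) → Replacement y
      order-to-discount-period M<s Q≤yM Q≰rest = record
        { plan          = moved
        ; feasible      = moved-feasible
        ; same-total    = transfer-ordered cleared 1≤M M≤n 1≤s s≤n refl refl
        ; cheaper       = transfer-cost cleared 1≤M M≤n 1≤s s≤n refl ≤-refl exchange
        ; late-discount = lastPrice-≤-discounted moved 1≤s s≤n
                            (subst (λ a → Q ≤ ℕ→ℚ a) (sym (update-≡ cleared s _))
                                   (≤-trans Q≤yM (ℕ→ℚ-mono-≤ (ℕ.m≤n+m (y M) (cleared s)))))
        }
        where
        moved : Plan
        moved = cleared [ s ]≔ cleared s ℕ.+ y M
        cleared-s : cleared s ≡ 0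
        cleared-s = trans (update-≢ y 0 (ℕ.>⇒≢ M<s)) (idle s M<s s≤n)
        exchange : purchase P s (cleared s ℕ.+ y M) + purchase P M 0
                   ≤ purchase P s (cleared s) + purchase P M (y M)
        exchange = subst (λ a → purchase P s (a ℕ.+ y M) + purchase P M 0 ≤ purchase P s a + purchase P M (y M))
                         (sym cleared-s) (exchange-whole-order (y M) (ℕ.<⇒≤ M<s))
        moved-late : ∀ {t} → s ℕ.≤ t → ordered moved t ≡ ordered y t
        moved-late s≤t = transfer-ordered cleared 1≤M (ℕ.≤-trans (ℕ.<⇒≤ M<s) s≤t) 1≤s s≤t refl refl
        moved-feasible : Feasible n moved
        moved-feasible t t≤n = case t ℕ.<? s of λ where
            (yes t<s) → subst (0ℚ ≤_) (sym (inv-update-< cleared _ t<s)) (cleared-feasible-before-s Q≰rest t t<s)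
            (no t≮s)  → subst (0ℚ ≤_) (inv-cong y moved t (sym (moved-late (ℕ.≮⇒≥ t≮s)))) (fy t t≤n)

      ordered-x≤cleared : y M ℕ.< k → ordered x n ℕ.≤ ordered cleared n
      ordered-x≤cleared yM<k = ℕ.+-cancelʳ-≤ (y M) _ _ (begin
        ordered x n ℕ.+ y M        ≤⟨ ℕ.+-monoʳ-≤ (ordered x n) (ℕ.<⇒≤ yM<k) ⟩
        ordered x n ℕ.+ k          ≡⟨ surplus ⟨
        ordered y n                ≡⟨ ordered-split y 0 (y M) 1≤M M≤n refl ⟩
        ordered cleared n ℕ.+ y M  ∎)
        where open ℕ.≤-Reasoning

      replace : (∀ {v} → Feasible n v → NoOrdersBetween m n v → ordered x n ℕ.≤ ordered v n → Replacement v) →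
                Replacement y
      replace recurse with Q ≤? ℕ→ℚ (y M) | s ℕ.≤? M
      ... | yes Q≤yM | yes s≤M =
        self-replaces fy (≤∞-trans (lastPrice-≤-discounted y 1≤M M≤n Q≤yM) (fin≤fin (p₂-antitone s≤M)))
      ... | yes Q≤yM | no s≰M with Q ≤? ℕ→ℚ (y M ℕ.∸ k)
      ...   | yes Q≤rest = surplus-to-discount-period (ℕ.<⇒≤ (ℕ.≰⇒> s≰M)) Q≤rest
      ...   | no  Q≰rest = order-to-discount-period (ℕ.≰⇒> s≰M) Q≤yM Q≰rest
      replace recurse | no Q≰yM | _ with k ℕ.≤? y M
      ...   | yes k≤yM = transfer-to-last-period 1≤M M≤n Q≰yM (ℕ.m∸n+n≡m k≤yM) (x-replaces-trimmed k≤yM)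
      ...   | no  k≰yM = transfer-to-last-period 1≤M M≤n Q≰yM refl
                           (recurse (trimmed-feasible 0 larger) (clear-noOrders idle) larger)
        where larger = ordered-x≤cleared (ℕ.≰⇒> k≰yM)

    replacement : ∀ m → m ℕ.≤ n → ∀ {y} → Feasible n y → NoOrdersBetween m n y →
                  ordered x n ℕ.≤ ordered y n → Replacement y
    replacement zero _ {y} fy idle x≤y =
      x-replaces fy (trans empty (sym (ℕ.n≤0⇒n≡0 (subst (ordered x n ℕ.≤_) empty x≤y))))
      where
      empty : ordered y n ≡ 0
      empty = ordered-constant y z≤n idle
    replacement (suc m) M≤n {y} fy idle x≤y with ordered y n ℕ.≟ ordered x n
    ... | yes same  = x-replaces fy same
    ... | no differ = Surplus.replace M≤n fy idle (ℕ.≤∧≢⇒< x≤y (≢-sym differ)) (replacement m (ℕ.<⇒≤ M≤n))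

  optimal-with-lastPrice-≤ : ∀ {n f w x y q} → f < w → Optimal P n f x → lastPrice P x n ≡ just q →
                             Optimal P n w y → Σ Plan λ u → Optimal P n w u × lastPrice P u n ≤∞ just q
  optimal-with-lastPrice-≤ {n} {x = x} {y} f<w ((fx , xf) , x-min) x-last ((fy , yw) , y-min)
    with lastPrice-just x x-last
  ... | s , 1≤s , s≤n , Q≤xs , refl =
    plan , ((feasible , trans (inv-cong plan y n same-total) yw) , λ z fz → ≤-trans cheaper (y-min z fz)) ,
    late-discount
    where
    x-optimal : ∀ z → Feasible n z → ordered z n ≡ ordered x n → cost P x n ≤ cost P z n
    x-optimal z fz same = x-min z (fz , trans (inv-cong z x n same) xf)
    x≤y : ordered x n ℕ.≤ ordered y n
    x≤y = ℕ.≮⇒≥ λ y<x → <-irrefl refl (<-≤-trans f<w (subst₂ _≤_ yw xf (inv-mono y x n (ℕ.<⇒≤ y<x))))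
    open Exchange n x s fx x-optimal 1≤s s≤n Q≤xs
    open Replacement (replacement n ℕ.≤-refl fy (λ j n<j j≤n → contradiction j≤n (ℕ.<⇒≱ n<j)) x≤y)

open import Data.Maybe.Base using (just; nothing)
open import Data.Nat using (ℕ; _≤_; _∸_)
open import Data.Product.Base using (_,_)
open import Data.Rational using (ℚ; _<_; 0ℚ) renaming (_≤_ to _≤ℚ_)
open Preliminaries using (≤∞-trans)
open LotSizing using (optimal-with-lastPrice-≤)

lemma2 : (P : Instance) (i : ℕ) → 1 ≤ i →
    (f w : ℚ) → 0ℚ ≤ℚ f → f < w →
    Attainable P (i ∸ 1) f → Attainable P (i ∸ 1) w →
    (pf pw : ℚ∞) → IsMinLastPrice P (i ∸ 1) f pf → IsMinLastPrice P (i ∸ 1) w pw →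
    pw ≤∞ pf
lemma2 P i _ f w _ f<w _ _ nothing  pw _ _ = pw ≤∞top
lemma2 P i _ f w _ f<w _ _ (just q) pw ((x , x-optimal , x-last) , _) ((y , y-optimal , _) , pw-minimal)
  with optimal-with-lastPrice-≤ P f<w x-optimal x-last y-optimal
... | u , u-optimal , u-last = ≤∞-trans (pw-minimal u u-optimal) u-last
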